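{- Let $G$ be a prereduced graph, $v$ a vertex and $H$ a hole of $G$. Then $N_H[v]=N[v]\cap H$ consists of consecutive vertices of $H$ (i.e., forms a contiguous segment in the cyclic order of $H$). Moreover, either $N_H[v]=H$ or $|N_H[v]|<|H|-7$.
   Context: Graphs are finite, simple, undirected. A hole is an induced cycle of length at least $4$, identified with its vertex set. A minimal forbidden set is $X\subseteq V(G)$ with $G[X]$ not an interval graph but every proper subset inducing an interval graph; $G$ is prereduced if it has no minimal forbidden set of at most $10$ vertices. -}

module Defs where

open import Data.Nat using (ℕ; _≤_; _<_; _+_; _%_; NonZero)
open import Data.Bool using (Bool; true; false; _∨_)
open import Data.Fin using (Fin; toℕ; _≟_)
open import Data.Fin.Properties using (any?)
open import Data.Fin.Subset using (Subset; _∈_; _⊂_; _∩_; ∣_∣)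
open import Data.Vec using (tabulate)
open import Data.Product using (Σ; _×_; _,_; proj₁; proj₂; ∃-syntax)
open import Data.Sum using (_⊎_)
open import Relation.Nullary using (¬_; does)
open import Relation.Binary.PropositionalEquality using (_≡_; _≢_)
open import Function.Bundles using (_⇔_)
open import Function.Definitions using (Injective)

record Graph : Set where
  field
    n      : ℕ
    adj    : Fin n → Fin n → Bool
    sym    : ∀ u v → adj u v ≡ adj v u
    irrefl : ∀ v → adj v v ≡ false

open Graph public

Adj : (G : Graph) → Fin (n G) → Fin (n G) → Set
Adj G u v = adj G u v ≡ true

-- Closed intervals [l , r] with natural endpoints (l ≤ r required separately).
Interval : Set
Interval = ℕ × ℕ

Intersect : Interval → Interval → Set
Intersect (a , b) (c , d) = a ≤ d × c ≤ b

IsIntervalOn : (G : Graph) → Subset (n G) → Set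
IsIntervalOn G X =
  Σ (Fin (n G) → Interval) λ I →
    (∀ u → u ∈ X → proj₁ (I u) ≤ proj₂ (I u)) ×
    (∀ u w → u ∈ X → w ∈ X → u ≢ w → (Adj G u w ⇔ Intersect (I u) (I w)))

MinimalForbidden : (G : Graph) → Subset (n G) → Set
MinimalForbidden G X =
  ¬ IsIntervalOn G X × (∀ Y → Y ⊂ X → IsIntervalOn G Y)

Prereduced : Graph → Set
Prereduced G = ∀ X → MinimalForbidden G X → ¬ (∣ X ∣ ≤ 10)

CycAdj : (k : ℕ) .{{_ : NonZero k}} → Fin k → Fin k → Set
CycAdj k i j = toℕ j ≡ (toℕ i + 1) % k ⊎ toℕ i ≡ (toℕ j + 1) % k

IsHole : (G : Graph) (k : ℕ) .{{_ : NonZero k}} → (Fin k → Fin (n G)) → Set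
IsHole G k h =
  4 ≤ k × Injective _≡_ _≡_ h × (∀ i j → Adj G (h i) (h j) ⇔ CycAdj k i j)

holeSet : (G : Graph) {k : ℕ} → (Fin k → Fin (n G)) → Subset (n G)
holeSet G h = tabulate λ x → does (any? λ i → h i ≟ x)

closedNbhd : (G : Graph) → Fin (n G) → Subset (n G)
closedNbhd G v = tabulate λ u → does (u ≟ v) ∨ adj G v u

nbhdInHole : (G : Graph) {k : ℕ} → (Fin k → Fin (n G)) → Fin (n G) → Subset (n G)
nbhdInHole G h v = closedNbhd G v ∩ holeSet G h

Consecutive : (G : Graph) (k : ℕ) .{{_ : NonZero k}} →
              (Fin k → Fin (n G)) → Subset (n G) → Set
Consecutive G k h S =
  Σ (Fin k) λ s → Σ ℕ λ ℓ → ℓ ≤ k ×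
    (∀ i → (h i ∈ S) ⇔ (∃[ t ] (t < ℓ × toℕ i ≡ (toℕ s + t) % k)))

module Submission where

-- Interval graphs contain no induced cycle of length at least 4 and no asteroidal
-- triple, so in a prereduced graph no set of at most 10 vertices carries either.
-- In particular every hole has length at least 11, and the closed neighbourhood of a
-- vertex on a hole meets it in three consecutive vertices. For v off the hole, go
-- around the hole: if two neighbours of v are separated by 1 to 7 non-neighbours, v
-- and that segment form a short hole, so all gaps between runs of neighbours have
-- length at least 8. If there were two runs, v joined through the first one to the
-- hole vertex just before it, and through the second one to the hole vertices two
-- steps before and after it, would give an asteroidal triple on 9 vertices. So the
-- neighbours form one run, which is all of the hole or misses at least 8 of its vertices.

open import Defs hiding (sym)
open import Data.Bool using (Bool; true; false; not; _∨_; _∧_)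
open import Data.Bool.Properties using (¬-not; ∧-identityʳ; ∨-zeroʳ) renaming (_≟_ to _≟ᵇ_)
open import Data.Empty using (⊥; ⊥-elim)
open import Data.Fin using (Fin; toℕ; _≟_)
open import Data.Fin.Properties using (toℕ-fromℕ<; toℕ-injective; toℕ<n; any?)
open import Data.Nat.DivMod using (_mod_; _%_; %-distribˡ-+; m%n%n≡m%n; m<n⇒m%n≡m; [m+n]%n≡m%n; m%n≤m; m%n≤n; m%n<n)
open import Data.Fin.Subset using (Subset; _∈_; _⊆_; _⊂_; _∪_; _∩_; ∣_∣; ⋃; ⁅_⁆; inside; outside)
open import Data.Fin.Subset.Properties using (⊆-antisym; p∩q⊆q; p⊂q⇒∣p∣<∣q∣; p⊆q⇒∣p∣≤∣q∣; ∣⊥∣≡0; ∣⁅x⁆∣≡1; ∣p∣≤∣x∷p∣; x∈⁅x⁆; x∈p∪q⁺)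
open import Data.List using (List; []; _∷_; _++_; length; map; applyUpTo; upTo)
open import Data.List.Extrema.Nat using (argmin; argmin-all; f[argmin]≤f[xs])
open import Data.List.Membership.Propositional renaming (_∈_ to _∈ˡ_)
open import Data.List.Membership.Propositional.Properties using (∈-++⁺ˡ; ∈-++⁺ʳ; ∈-applyUpTo⁺; ∈-upTo⁺; ∈-upTo⁻)
open import Data.List.Properties using (length-applyUpTo)
open import Data.List.Relation.Unary.All as All using (All; []; _∷_)
open import Data.List.Relation.Unary.Any using (here; there)
open import Data.Nat using (ℕ; zero; suc; pred; _+_; _∸_; _≤_; _<_; _≤?_; z≤n; s≤s; NonZero)
open import Data.Nat.Properties hiding (_≟_)
open import Algebra.Properties.CommutativeSemigroup +-commutativeSemigroup using (x∙yz≈y∙xz)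
open import Data.Product using (∃-syntax; ∃₂; _×_; _,_; proj₁; proj₂)
open import Data.Sum using (_⊎_; inj₁; inj₂; [_,_]′)
open import Data.Vec using ([]; _∷_; lookup)
open import Data.Vec.Properties using (lookup-zipWith; lookup∘tabulate; []=⇒lookup; lookup⇒[]=)
open import Function.Bundles using (Equivalence; mk⇔)
open import Relation.Nullary using (¬_; yes; no; does)
open import Relation.Nullary.Decidable using (dec-true; dec-false)
open import Relation.Binary.PropositionalEquality using (_≡_; _≢_; refl; sym; trans; cong; subst; subst₂; cong₂; module ≡-Reasoning)

true≢false : true ≢ false
true≢false ()

setOf : ∀ {N} → List (Fin N) → Subset N
setOf xs = ⋃ (map ⁅_⁆ xs)

∣p∪q∣≤∣p∣+∣q∣ : ∀ {N} (p q : Subset N) → ∣ p ∪ q ∣ ≤ ∣ p ∣ + ∣ q ∣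
∣p∪q∣≤∣p∣+∣q∣ [] [] = z≤n
∣p∪q∣≤∣p∣+∣q∣ (inside ∷ p) (b ∷ q) = s≤s (≤-trans (∣p∪q∣≤∣p∣+∣q∣ p q) (+-monoʳ-≤ ∣ p ∣ (∣p∣≤∣x∷p∣ b q)))
∣p∪q∣≤∣p∣+∣q∣ (outside ∷ p) (inside ∷ q) = subst (suc ∣ p ∪ q ∣ ≤_) (sym (+-suc ∣ p ∣ ∣ q ∣)) (s≤s (∣p∪q∣≤∣p∣+∣q∣ p q))
∣p∪q∣≤∣p∣+∣q∣ (outside ∷ p) (outside ∷ q) = ∣p∪q∣≤∣p∣+∣q∣ p q

∣setOf∣≤length : ∀ {N} (xs : List (Fin N)) → ∣ setOf xs ∣ ≤ length xs
∣setOf∣≤length {N} [] = ≤-reflexive (∣⊥∣≡0 N)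
∣setOf∣≤length (x ∷ xs) = begin
  ∣ ⁅ x ⁆ ∪ setOf xs ∣       ≤⟨ ∣p∪q∣≤∣p∣+∣q∣ ⁅ x ⁆ (setOf xs) ⟩
  ∣ ⁅ x ⁆ ∣ + ∣ setOf xs ∣   ≡⟨ cong (_+ ∣ setOf xs ∣) (∣⁅x⁆∣≡1 x) ⟩
  suc ∣ setOf xs ∣           ≤⟨ s≤s (∣setOf∣≤length xs) ⟩
  suc (length xs)            ∎
  where open ≤-Reasoning

∈setOf⁺ : ∀ {N} {x : Fin N} {xs} → x ∈ˡ xs → x ∈ setOf xs
∈setOf⁺ (here refl) = x∈p∪q⁺ (inj₁ (x∈⁅x⁆ _))
∈setOf⁺ {xs = y ∷ _} (there x∈xs) = x∈p∪q⁺ {p = ⁅ y ⁆} (inj₂ (∈setOf⁺ x∈xs))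

argmin≤ : (f : ℕ → ℕ) (M : ℕ) → ∃[ i ] (i ≤ M × ∀ j → j ≤ M → f i ≤ f j)
argmin≤ f M =
  argmin f 0 (upTo (suc M)) ,
  ≤-pred (argmin-all f (s≤s z≤n) (All.tabulate ∈-upTo⁻)) ,
  λ j j≤M → All.lookup (f[argmin]≤f[xs] {f = f} 0 (upTo (suc M))) (∈-upTo⁺ (s≤s j≤M))

Far : (G : Graph) → Fin (n G) → Fin (n G) → Set
Far G u w = u ≢ w × ¬ Adj G u w

Adj-sym : (G : Graph) {u w : Fin (n G)} → Adj G u w → Adj G w u
Adj-sym G {u} {w} uw = trans (Graph.sym G w u) uw

Adj⇒≢ : (G : Graph) {u w : Fin (n G)} → Adj G u w → u ≢ w
Adj⇒≢ G {u} uu refl = true≢false (trans (sym uu) (irrefl G u))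

Far-sym : (G : Graph) {u w : Fin (n G)} → Far G u w → Far G w u
Far-sym G (u≢w , ¬uw) = (λ w≡u → u≢w (sym w≡u)) , (λ wu → ¬uw (Adj-sym G wu))

data Walk (G : Graph) : Fin (n G) → Fin (n G) → Set where
  []  : ∀ {u} → Walk G u u
  _∷_ : ∀ {u w x} → Adj G u w → Walk G w x → Walk G u x

module _ {G : Graph} where

  steps : ∀ {u x} → Walk G u x → List (Fin (n G))
  steps [] = []
  steps (_∷_ {w = w} _ p) = w ∷ steps p

  vertices : ∀ {u x} → Walk G u x → List (Fin (n G))
  vertices {u} p = u ∷ steps p

  All-last : ∀ {P : Fin (n G) → Set} {u x} (p : Walk G u x) → All P (vertices p) → P x
  All-last [] (Px ∷ []) = Px
  All-last (_ ∷ p) (_ ∷ Ps) = All-last p Ps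

  Avoids : ∀ {u x} → Walk G u x → Fin (n G) → Set
  Avoids p m = All (λ t → Far G t m) (vertices p)

-- The cycle c 0, c 1, …, c M of length suc M.
record InducedCycle (G : Graph) (M : ℕ) (c : ℕ → Fin (n G)) : Set where
  field
    long      : 3 ≤ M
    edge      : ∀ t → t < M → Adj G (c t) (c (suc t))
    closing   : Adj G (c M) (c 0)
    chordless : ∀ {t u} → 2 + t ≤ u → u ≤ M → u < t + M → Far G (c t) (c u)

twoFarNeighbours : ∀ {G M c} → InducedCycle G M c → ∀ i → i ≤ M →
  ∃₂ λ a b → a ≤ M × b ≤ M × Adj G (c a) (c i) × Adj G (c i) (c b) × Far G (c a) (c b)
twoFarNeighbours {G} {M} cyc zero _ =
  M , 1 , ≤-refl , ≤-trans (s≤s z≤n) long , closing , edge 0 (≤-trans (s≤s z≤n) long) ,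
  Far-sym G (chordless long ≤-refl ≤-refl)
  where open InducedCycle cyc
twoFarNeighbours {G} {M} cyc (suc j) j<M with m≤n⇒m<n∨m≡n j<M
... | inj₁ 1+j<M =
  j , suc (suc j) , ≤-trans (n≤1+n j) j<M , 1+j<M , edge j j<M , edge (suc j) 1+j<M ,
  chordless ≤-refl 1+j<M (≤-trans (≤-reflexive (+-comm 3 j)) (+-monoʳ-≤ j long))
  where open InducedCycle cyc
... | inj₂ refl =
  j , 0 , n≤1+n j , z≤n , edge j ≤-refl , closing ,
  Far-sym G (chordless (≤-pred long) (n≤1+n j) ≤-refl)
  where open InducedCycle cyc

-- An asteroidal triple witnessed by walks from a common centre: joining two arms
-- gives a walk between their ends avoiding the closed neighbourhood of the third.
record AsteroidalTriple (G : Graph) : Set where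
  field
    centre end₁ end₂ end₃ : Fin (n G)
    arm₁ : Walk G centre end₁
    arm₂ : Walk G centre end₂
    arm₃ : Walk G centre end₃
    avoids₁₂ : Avoids arm₁ end₂
    avoids₁₃ : Avoids arm₁ end₃
    avoids₂₁ : Avoids arm₂ end₁
    avoids₂₃ : Avoids arm₂ end₃
    avoids₃₁ : Avoids arm₃ end₁
    avoids₃₂ : Avoids arm₃ end₂

  support : List (Fin (n G))
  support = centre ∷ steps arm₁ ++ steps arm₂ ++ steps arm₃

  arm₁⊆support : ∀ {u} → u ∈ˡ vertices arm₁ → u ∈ˡ support
  arm₁⊆support (here refl) = here refl
  arm₁⊆support (there u∈) = there (∈-++⁺ˡ u∈)

  arm₂⊆support : ∀ {u} → u ∈ˡ vertices arm₂ → u ∈ˡ support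
  arm₂⊆support (here refl) = here refl
  arm₂⊆support (there u∈) = there (∈-++⁺ʳ (steps arm₁) (∈-++⁺ˡ u∈))

  arm₃⊆support : ∀ {u} → u ∈ˡ vertices arm₃ → u ∈ˡ support
  arm₃⊆support (here refl) = here refl
  arm₃⊆support (there u∈) = there (∈-++⁺ʳ (steps arm₁) (∈-++⁺ʳ (steps arm₂) u∈))

-- Interval representations

module Interval {G : Graph} {X : Subset (n G)} (iv : IsIntervalOn G X) where

  private
    V = Fin (n G)

  L R : V → ℕ
  L u = proj₁ (proj₁ iv u)
  R u = proj₂ (proj₁ iv u)

  L≤R : ∀ {u} → u ∈ X → L u ≤ R u
  L≤R {u} u∈X = proj₁ (proj₂ iv) u u∈X

  Contains : ℕ → V → Set
  Contains x u = L u ≤ x × x ≤ R u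

  Before : V → V → Set
  Before u w = R u < L w

  adjacent⇒intersect : ∀ {u w} → u ∈ X → w ∈ X → Adj G u w → L u ≤ R w × L w ≤ R u
  adjacent⇒intersect {u} {w} u∈X w∈X uw =
    Equivalence.to (proj₂ (proj₂ iv) u w u∈X w∈X (Adj⇒≢ G uw)) uw

  sharedPoint⇒¬Far : ∀ {u w x} → u ∈ X → w ∈ X → Contains x u → Contains x w → ¬ Far G u w
  sharedPoint⇒¬Far {u} {w} u∈X w∈X (Lu≤x , x≤Ru) (Lw≤x , x≤Rw) (u≢w , ¬uw) =
    ¬uw (Equivalence.from (proj₂ (proj₂ iv) u w u∈X w∈X u≢w) (≤-trans Lu≤x x≤Rw , ≤-trans Lw≤x x≤Ru))

  Far⇒ordered : ∀ {u w} → u ∈ X → w ∈ X → Far G u w → Before u w ⊎ Before w u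
  Far⇒ordered {u} {w} u∈X w∈X (u≢w , ¬uw) with L u ≤? R w | L w ≤? R u
  ... | yes Lu≤Rw | yes Lw≤Ru = ⊥-elim (¬uw (Equivalence.from (proj₂ (proj₂ iv) u w u∈X w∈X u≢w) (Lu≤Rw , Lw≤Ru)))
  ... | _         | no Lw≰Ru  = inj₁ (≰⇒> Lw≰Ru)
  ... | no Lu≰Rw  | yes _     = inj₂ (≰⇒> Lu≰Rw)

  Before-trans : ∀ {u w x} → w ∈ X → Before u w → Before w x → Before u x
  Before-trans w∈X uw wx = <-trans uw (≤-<-trans (L≤R w∈X) wx)

  Before-irrefl : ∀ {u} → u ∈ X → ¬ Before u u
  Before-irrefl u∈X uu = <-irrefl refl (<-≤-trans uu (L≤R u∈X))

  -- A walk avoiding N[m] inside X cannot pass over any point of the interval of m.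
  walk-missesʳ : ∀ {u y m x} (p : Walk G u y) → All (_∈ X) (vertices p) → Avoids p m → m ∈ X →
                 Contains x m → L u ≤ x → x ≤ R y → ⊥
  walk-missesʳ [] (u∈X ∷ []) (far ∷ []) m∈X xm Lu≤x x≤Ry = sharedPoint⇒¬Far u∈X m∈X (Lu≤x , x≤Ry) xm far
  walk-missesʳ {u} {x = x} (uw ∷ p) (u∈X ∷ in-X) (far ∷ avoids) m∈X xm Lu≤x x≤Ry with x ≤? R u
  ... | yes x≤Ru = sharedPoint⇒¬Far u∈X m∈X (Lu≤x , x≤Ru) xm far
  ... | no x≰Ru  = walk-missesʳ p in-X avoids m∈X xm
                     (≤-trans (proj₂ (adjacent⇒intersect u∈X (All.head in-X) uw)) (<⇒≤ (≰⇒> x≰Ru))) x≤Ry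

  walk-missesˡ : ∀ {u y m x} (p : Walk G u y) → All (_∈ X) (vertices p) → Avoids p m → m ∈ X →
                 Contains x m → L y ≤ x → x ≤ R u → ⊥
  walk-missesˡ [] (u∈X ∷ []) (far ∷ []) m∈X xm Ly≤x x≤Ru = sharedPoint⇒¬Far u∈X m∈X (Ly≤x , x≤Ru) xm far
  walk-missesˡ {u} {x = x} (uw ∷ p) (u∈X ∷ in-X) (far ∷ avoids) m∈X xm Ly≤x x≤Ru with L u ≤? x
  ... | yes Lu≤x = sharedPoint⇒¬Far u∈X m∈X (Lu≤x , x≤Ru) xm far
  ... | no Lu≰x  = walk-missesˡ p in-X avoids m∈X xm Ly≤x
                     (≤-trans (<⇒≤ (≰⇒> Lu≰x)) (proj₁ (adjacent⇒intersect u∈X (All.head in-X) uw)))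

  -- The vertex of a cycle whose interval ends first meets both its neighbours at that point.
  noInducedCycle : ∀ {M c} → InducedCycle G M c → (∀ t → t ≤ M → c t ∈ X) → ⊥
  noInducedCycle {M} {c} cyc in-X with argmin≤ (λ t → R (c t)) M
  ... | i , i≤M , minimal with twoFarNeighbours cyc i i≤M
  ... | a , b , a≤M , b≤M , ai , ib , far =
    sharedPoint⇒¬Far (in-X a a≤M) (in-X b b≤M)
      (proj₁ (adjacent⇒intersect (in-X a a≤M) (in-X i i≤M) ai) , minimal a a≤M)
      (proj₂ (adjacent⇒intersect (in-X i i≤M) (in-X b b≤M) ib) , minimal b b≤M)
      far

  Between : V → V → V → Set
  Between a m b = (Before a m × Before m b) ⊎ (Before b m × Before m a)

  separates : ∀ {c a b m} (p : Walk G c a) (q : Walk G c b) →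
              All (_∈ X) (vertices p) → All (_∈ X) (vertices q) → Avoids p m → Avoids q m → m ∈ X →
              Between a m b → ⊥
  separates {c} {m = m} p q p-in q-in p-avoids q-avoids m∈X (inj₁ (am , mb)) with L m ≤? R c
  ... | yes Lm≤Rc = walk-missesˡ p p-in p-avoids m∈X (≤-refl , L≤R m∈X)
                      (≤-trans (L≤R (All-last p p-in)) (<⇒≤ am)) Lm≤Rc
  ... | no Lm≰Rc  = walk-missesʳ q q-in q-avoids m∈X (≤-refl , L≤R m∈X)
                      (≤-trans (L≤R (All.head q-in)) (<⇒≤ (≰⇒> Lm≰Rc)))
                      (≤-trans (L≤R m∈X) (≤-trans (<⇒≤ mb) (L≤R (All-last q q-in))))
  separates p q p-in q-in p-avoids q-avoids m∈X (inj₂ bma) =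
    separates q p q-in p-in q-avoids p-avoids m∈X (inj₁ bma)

  oneBetween : ∀ {a b c} → a ∈ X → b ∈ X → c ∈ X →
               Before a b ⊎ Before b a → Before a c ⊎ Before c a → Before b c ⊎ Before c b →
               Between b a c ⊎ Between a b c ⊎ Between a c b
  oneBetween a∈X b∈X c∈X (inj₁ ab) (inj₁ ac) (inj₁ bc) = inj₂ (inj₁ (inj₁ (ab , bc)))
  oneBetween a∈X b∈X c∈X (inj₁ ab) (inj₁ ac) (inj₂ cb) = inj₂ (inj₂ (inj₁ (ac , cb)))
  oneBetween a∈X b∈X c∈X (inj₁ ab) (inj₂ ca) (inj₁ bc) =
    ⊥-elim (Before-irrefl a∈X (Before-trans c∈X (Before-trans b∈X ab bc) ca))
  oneBetween a∈X b∈X c∈X (inj₁ ab) (inj₂ ca) (inj₂ cb) = inj₁ (inj₂ (ca , ab))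
  oneBetween a∈X b∈X c∈X (inj₂ ba) (inj₁ ac) (inj₁ bc) = inj₁ (inj₁ (ba , ac))
  oneBetween a∈X b∈X c∈X (inj₂ ba) (inj₁ ac) (inj₂ cb) =
    ⊥-elim (Before-irrefl a∈X (Before-trans b∈X (Before-trans c∈X ac cb) ba))
  oneBetween a∈X b∈X c∈X (inj₂ ba) (inj₂ ca) (inj₁ bc) = inj₂ (inj₂ (inj₂ (bc , ca)))
  oneBetween a∈X b∈X c∈X (inj₂ ba) (inj₂ ca) (inj₂ cb) = inj₂ (inj₁ (inj₂ (cb , ba)))

  noAsteroidalTriple : (T : AsteroidalTriple G) → (∀ {u} → u ∈ˡ AsteroidalTriple.support T → u ∈ X) → ⊥
  noAsteroidalTriple T in-X =
    [ separates arm₂ arm₃ arm₂-in arm₃-in avoids₂₁ avoids₃₁ e₁∈X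
    , [ separates arm₁ arm₃ arm₁-in arm₃-in avoids₁₂ avoids₃₂ e₂∈X
      , separates arm₁ arm₂ arm₁-in arm₂-in avoids₁₃ avoids₂₃ e₃∈X ]′ ]′
    (oneBetween e₁∈X e₂∈X e₃∈X (Far⇒ordered e₁∈X e₂∈X (All-last arm₁ avoids₁₂))
                               (Far⇒ordered e₁∈X e₃∈X (All-last arm₁ avoids₁₃))
                               (Far⇒ordered e₂∈X e₃∈X (All-last arm₂ avoids₂₃)))
    where
      open AsteroidalTriple T
      arm₁-in = All.tabulate (λ u∈ → in-X (arm₁⊆support u∈))
      arm₂-in = All.tabulate (λ u∈ → in-X (arm₂⊆support u∈))
      arm₃-in = All.tabulate (λ u∈ → in-X (arm₃⊆support u∈))
      e₁∈X = All-last arm₁ arm₁-in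
      e₂∈X = All-last arm₂ arm₂-in
      e₃∈X = All-last arm₃ arm₃-in

¬¬-∀-Subset : ∀ {N} (P : Subset N → Set) → (∀ Y → ¬ ¬ P Y) → ¬ ¬ (∀ Y → P Y)
¬¬-∀-Subset {zero} P ¬¬P ¬∀P = ¬¬P [] (λ P[] → ¬∀P (λ { [] → P[] }))
¬¬-∀-Subset {suc N} P ¬¬P ¬∀P =
  ¬¬-∀-Subset (λ Y → P (outside ∷ Y)) (λ Y → ¬¬P (outside ∷ Y)) λ ∀P₀ →
  ¬¬-∀-Subset (λ Y → P (inside ∷ Y)) (λ Y → ¬¬P (inside ∷ Y)) λ ∀P₁ →
  ¬∀P (λ { (outside ∷ Y) → ∀P₀ Y ; (inside ∷ Y) → ∀P₁ Y })

¬¬-→ : {A B : Set} → (A → ¬ ¬ B) → ¬ ¬ (A → B)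
¬¬-→ ¬¬B ¬[A→B] = ¬[A→B] (λ a → ⊥-elim (¬¬B a (λ b → ¬[A→B] (λ _ → b))))

module _ {G : Graph} (pre : Prereduced G) where

  -- Constructively we only get ¬¬: a non-interval set need not contain a minimal one
  -- we can exhibit. This suffices, as every use below derives ⊥.
  small⇒¬¬interval : ∀ X → ∣ X ∣ ≤ 10 → ¬ ¬ IsIntervalOn G X
  small⇒¬¬interval X = below (suc ∣ X ∣) X ≤-refl
    where
      below : ∀ m X → ∣ X ∣ < m → ∣ X ∣ ≤ 10 → ¬ ¬ IsIntervalOn G X
      below (suc m) X (s≤s ∣X∣≤m) ∣X∣≤10 ¬interval =
        ¬¬-∀-Subset (λ Y → Y ⊂ X → IsIntervalOn G Y)
          (λ Y → ¬¬-→ λ Y⊂X → below m Y (≤-trans (p⊂q⇒∣p∣<∣q∣ Y⊂X) ∣X∣≤m)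
                                         (≤-trans (<⇒≤ (p⊂q⇒∣p∣<∣q∣ Y⊂X)) ∣X∣≤10))
          (λ proper-subsets → pre X (¬interval , proper-subsets) ∣X∣≤10)

  noShortInducedCycle : ∀ {M c} → InducedCycle G M c → M ≤ 9 → ⊥
  noShortInducedCycle {M} {c} cyc M≤9 =
    small⇒¬¬interval (setOf cycle)
      (≤-trans (∣setOf∣≤length cycle) (≤-trans (≤-reflexive (length-applyUpTo c (suc M))) (s≤s M≤9)))
      (λ iv → Interval.noInducedCycle iv cyc (λ t t≤M → ∈setOf⁺ (∈-applyUpTo⁺ c (s≤s t≤M))))
    where cycle = applyUpTo c (suc M)

  noSmallAsteroidalTriple : (T : AsteroidalTriple G) → length (AsteroidalTriple.support T) ≤ 10 → ⊥
  noSmallAsteroidalTriple T small =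
    small⇒¬¬interval (setOf (AsteroidalTriple.support T)) (≤-trans (∣setOf∣≤length (AsteroidalTriple.support T)) small)
      (λ iv → Interval.noAsteroidalTriple iv T ∈setOf⁺)

module _ {k : ℕ} .{{_ : NonZero k}} where

  toℕ-mod : ∀ x → toℕ (x mod k) ≡ x % k
  toℕ-mod x = toℕ-fromℕ< _

  %-absorbˡ : ∀ x y → (x % k + y) % k ≡ (x + y) % k
  %-absorbˡ x y = begin
    (x % k + y) % k            ≡⟨ %-distribˡ-+ (x % k) y k ⟩
    (x % k % k + y % k) % k    ≡⟨ cong (λ z → (z + y % k) % k) (m%n%n≡m%n x k) ⟩
    (x % k + y % k) % k        ≡⟨ %-distribˡ-+ x y k ⟨
    (x + y) % k                ∎
    where open ≡-Reasoning

  [r+d]%k≢r : ∀ {r d} → r < k → 0 < d → d < k → (r + d) % k ≢ r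
  [r+d]%k≢r {r} {d} r<k 0<d d<k r+d%k≡r with r + d <? k
  ... | yes r+d<k = <-irrefl refl (subst (r <_) (trans (sym (m<n⇒m%n≡m r+d<k)) r+d%k≡r) (m<m+n r 0<d))
  ... | no r+d≮k = <-irrefl refl (begin-strict
          r            ≡⟨ r+d%k≡r ⟨
          (r + d) % k  ≡⟨ cong (_% k) (m∸n+n≡m k≤r+d) ⟨
          (w + k) % k  ≡⟨ [m+n]%n≡m%n w k ⟩
          w % k        ≤⟨ m%n≤m w k ⟩
          w            <⟨ +-cancelʳ-< k w r (begin-strict
                            w + k  ≡⟨ m∸n+n≡m k≤r+d ⟩
                            r + d  <⟨ +-monoʳ-< r d<k ⟩
                            r + k  ∎) ⟩
          r            ∎)
    where
      open ≤-Reasoning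
      k≤r+d = ≮⇒≥ r+d≮k
      w = r + d ∸ k

  %-absorbʳ : ∀ x y → (x + y % k) % k ≡ (x + y) % k
  %-absorbʳ x y = begin
    (x + y % k) % k  ≡⟨ cong (_% k) (+-comm x (y % k)) ⟩
    (y % k + x) % k  ≡⟨ %-absorbˡ y x ⟩
    (y + x) % k      ≡⟨ cong (_% k) (+-comm y x) ⟩
    (x + y) % k      ∎
    where open ≡-Reasoning

  %-injective-window : ∀ {x y} → x < y → y < x + k → x % k ≢ y % k
  %-injective-window {x} {y} x<y y<x+k x%k≡y%k =
    [r+d]%k≢r (m%n<n x k) (m<n⇒0<n∸m x<y)
      (+-cancelˡ-< x (y ∸ x) k (subst (_< x + k) (sym (m+[n∸m]≡n (<⇒≤ x<y))) y<x+k))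
      (begin
        (x % k + (y ∸ x)) % k  ≡⟨ %-absorbˡ x (y ∸ x) ⟩
        (x + (y ∸ x)) % k      ≡⟨ cong (_% k) (m+[n∸m]≡n (<⇒≤ x<y)) ⟩
        y % k                  ≡⟨ x%k≡y%k ⟨
        x % k                  ∎)
    where open ≡-Reasoning

  ∃offset : ∀ p (i : Fin k) → ∃[ t ] (t < k × (p + t) % k ≡ toℕ i)
  ∃offset p i = t , m%n<n _ k , (begin
    (p + t) % k                   ≡⟨ %-absorbˡ p t ⟨
    (p % k + t) % k               ≡⟨ %-absorbʳ (p % k) (toℕ i + (k ∸ p % k)) ⟩
    (p % k + (toℕ i + (k ∸ p % k))) % k
                                  ≡⟨ cong (_% k) (x∙yz≈y∙xz (p % k) (toℕ i) (k ∸ p % k)) ⟩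
    (toℕ i + (p % k + (k ∸ p % k))) % k
                                  ≡⟨ cong (λ z → (toℕ i + z) % k) (m+[n∸m]≡n (m%n≤n p k)) ⟩
    (toℕ i + k) % k               ≡⟨ [m+n]%n≡m%n (toℕ i) k ⟩
    toℕ i % k                     ≡⟨ m<n⇒m%n≡m (toℕ<n i) ⟩
    toℕ i                         ∎)
    where
      open ≡-Reasoning
      t = (toℕ i + (k ∸ p % k)) % k

-- Holes as periodic sequences

record CyclicHole (G : Graph) (k : ℕ) (C : ℕ → Fin (n G)) : Set where
  field
    long     : 4 ≤ k
    periodic : ∀ x → C (x + k) ≡ C x
    edge     : ∀ x → Adj G (C x) (C (suc x))
    far      : ∀ {x y} → 2 + x ≤ y → 2 + y ≤ x + k → Far G (C x) (C y)

unfoldHole : ∀ {G k} .{{_ : NonZero k}} {h} → IsHole G k h → CyclicHole G k (λ x → h (x mod k))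
unfoldHole {G} {k} {h} (4≤k , h-injective , cycAdj) = record
  { long     = 4≤k
  ; periodic = λ x → cong h (mod-cong ([m+n]%n≡m%n x k))
  ; edge     = λ x → Equivalence.from (cycAdj (x mod k) (suc x mod k))
                       (inj₁ (trans (toℕ-mod (suc x)) (sym (begin
                          (toℕ (x mod k) + 1) % k  ≡⟨ cong (λ r → (r + 1) % k) (toℕ-mod x) ⟩
                          (x % k + 1) % k          ≡⟨ %-absorbˡ x 1 ⟩
                          (x + 1) % k              ≡⟨ cong (_% k) (+-comm x 1) ⟩
                          suc x % k                ∎))))
  ; far      = far
  }
  where
    open ≡-Reasoning
    mod-cong : ∀ {x y} → x % k ≡ y % k → x mod k ≡ y mod k
    mod-cong {x} {y} eq = toℕ-injective (trans (toℕ-mod x) (trans eq (sym (toℕ-mod y))))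

    far : ∀ {x y} → 2 + x ≤ y → 2 + y ≤ x + k → Far G (h (x mod k)) (h (y mod k))
    far {x} {y} 2+x≤y 2+y≤x+k = distinct , nonadjacent
      where
        x<y : x < y
        x<y = ≤-trans (n≤1+n _) 2+x≤y
        y<x+k : y < x + k
        y<x+k = ≤-trans (n≤1+n _) 2+y≤x+k
        distinct : h (x mod k) ≢ h (y mod k)
        distinct eq = %-injective-window x<y y<x+k
          (trans (sym (toℕ-mod x)) (trans (cong toℕ (h-injective eq)) (toℕ-mod y)))
        nonadjacent : ¬ Adj G (h (x mod k)) (h (y mod k))
        nonadjacent adj with Equivalence.to (cycAdj (x mod k) (y mod k)) adj
        ... | inj₁ y≡x+1 = %-injective-window {x = x + 1} {y = y}
                (subst (λ z → suc z ≤ y) (+-comm 1 x) 2+x≤y)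
                (≤-trans y<x+k (+-monoˡ-≤ k (m≤m+n x 1)))
                (sym (begin
                  y % k                    ≡⟨ toℕ-mod y ⟨
                  toℕ (y mod k)            ≡⟨ y≡x+1 ⟩
                  (toℕ (x mod k) + 1) % k  ≡⟨ cong (λ r → (r + 1) % k) (toℕ-mod x) ⟩
                  (x % k + 1) % k          ≡⟨ %-absorbˡ x 1 ⟩
                  (x + 1) % k              ∎))
        ... | inj₂ x≡y+1 = %-injective-window {x = y + 1} {y = x + k}
                (subst (λ z → suc z ≤ x + k) (+-comm 1 y) 2+y≤x+k)
                (+-monoˡ-< k (≤-trans x<y (m≤m+n y 1)))
                (sym (begin
                  (x + k) % k              ≡⟨ [m+n]%n≡m%n x k ⟩
                  x % k                    ≡⟨ toℕ-mod x ⟨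
                  toℕ (x mod k)            ≡⟨ x≡y+1 ⟩
                  (toℕ (y mod k) + 1) % k  ≡⟨ cong (λ r → (r + 1) % k) (toℕ-mod y) ⟩
                  (y % k + 1) % k          ≡⟨ %-absorbˡ y 1 ⟩
                  (y + 1) % k              ∎))

rotateHole : ∀ {G k C} → CyclicHole G k C → ∀ z → CyclicHole G k (λ t → C (z + t))
rotateHole {G} {k} {C} hole z = record
  { long     = long
  ; periodic = λ x → trans (cong C (sym (+-assoc z x k))) (periodic (z + x))
  ; edge     = λ x → subst (λ y → Adj G (C (z + x)) (C y)) (sym (+-suc z x)) (edge (z + x))
  ; far      = λ {x} {y} 2+x≤y 2+y≤x+k → far
                 (subst (_≤ z + y) (x∙yz≈y∙xz z 2 x) (+-monoʳ-≤ z 2+x≤y))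
                 (subst₂ _≤_ (x∙yz≈y∙xz z 2 y) (sym (+-assoc z x k)) (+-monoʳ-≤ z 2+y≤x+k))
  }
  where open CyclicHole hole

holeCycle : ∀ {G M C} → CyclicHole G (suc M) C → InducedCycle G M C
holeCycle {G} {M} {C} hole = record
  { long      = ≤-pred long
  ; edge      = λ t _ → edge t
  ; closing   = subst (Adj G (C M)) (periodic 0) (edge M)
  ; chordless = λ {t} {u} 2+t≤u _ u<t+M → far 2+t≤u (subst (suc (suc u) ≤_) (sym (+-suc t M)) (s≤s u<t+M))
  }
  where open CyclicHole hole

holeLength≥11 : ∀ {G k C} → Prereduced G → CyclicHole G k C → 11 ≤ k
holeLength≥11 {k = zero} pre hole with CyclicHole.long hole
... | ()
holeLength≥11 {k = suc M} pre hole with 11 ≤? suc M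
... | yes 11≤k = 11≤k
... | no 11≰k = ⊥-elim (noShortInducedCycle pre (holeCycle hole) (≤-pred (≤-pred (≰⇒> 11≰k))))

-- Runs of a periodic Boolean sequence

ConstantOn : (ℕ → Bool) → ℕ → ℕ → Set
ConstantOn b i j = ∀ t → i ≤ t → t ≤ j → b t ≡ b i

nextChange : ∀ b {i} j → i ≤ j →
             ConstantOn b i j ⊎ ∃[ t ] (i ≤ t × t < j × ConstantOn b i t × b (suc t) ≢ b i)
nextChange b {i} j i≤j with m≤n⇒m<n∨m≡n i≤j
nextChange b zero _ | inj₁ ()
nextChange b (suc j) _ | inj₁ (s≤s i≤j) with nextChange b j i≤j
... | inj₂ (t , i≤t , t<j , constant , change) = inj₂ (t , i≤t , m<n⇒m<1+n t<j , constant , change)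
... | inj₁ constant with b (suc j) ≟ᵇ b _
...   | no change = inj₂ (j , i≤j , ≤-refl , constant , change)
...   | yes same = inj₁ λ t i≤t t≤1+j → [ (λ t<1+j → constant t i≤t (≤-pred t<1+j)) , (λ { refl → same }) ]′
                                         (m≤n⇒m<n∨m≡n t≤1+j)
nextChange b j i≤j | inj₂ refl = inj₁ (λ t i≤t t≤i → cong b (≤-antisym t≤i i≤t))

Run : ℕ → (ℕ → Bool) → ℕ → ℕ → Set
Run k b p ℓ = ℓ ≤ k × (∀ t → t < ℓ → b (p + t) ≡ true) × (∀ t → ℓ ≤ t → t < k → b (p + t) ≡ false)

Run-cong : ∀ {k b b′ p ℓ} → (∀ x → b x ≡ b′ x) → Run k b p ℓ → Run k b′ p ℓ
Run-cong b≗b′ (ℓ≤k , holds , fails) =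
  ℓ≤k , (λ t t<ℓ → trans (sym (b≗b′ _)) (holds t t<ℓ)) , (λ t ℓ≤t t<k → trans (sym (b≗b′ _)) (fails t ℓ≤t t<k))

GapsAtLeast : ℕ → (ℕ → Bool) → Set
GapsAtLeast g b = ∀ {x y} → x < y → b x ≡ true → b (suc x) ≡ false → b y ≡ true → x + g < y

-- Two runs of b, through 1 + p and from 2 + q to s, separated by failures at p, q
-- and 2 + s; the margins are those the asteroidal triple in noTwoRuns needs.
record TwoRuns (k : ℕ) (b : ℕ → Bool) : Set where
  field
    p q s     : ℕ
    3+p≤q     : 3 + p ≤ q
    2+q≤s     : 2 + q ≤ s
    4+s≤p+k   : 4 + s ≤ p + k
    false-p   : b p ≡ false
    true-1+p  : b (suc p) ≡ true
    false-q   : b q ≡ false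
    true-2+q  : b (2 + q) ≡ true
    true-s    : b s ≡ true
    false-2+s : b (2 + s) ≡ false

module _ {k g : ℕ} {b : ℕ → Bool} (periodic : ∀ x → b (x + k) ≡ b x) (4≤g : 4 ≤ g) (g≤k : g ≤ k)
         (gaps : GapsAtLeast g b) (¬twoRuns : ¬ TwoRuns k b) where

  private
    flip-true : ∀ {x y} → b y ≡ true → b x ≢ b y → b x ≡ false
    flip-true by≡true change = trans (¬-not change) (cong not by≡true)

    flip-false : ∀ {x y} → b y ≡ false → b x ≢ b y → b x ≡ true
    flip-false by≡false change = trans (¬-not change) (cong not by≡false)

    1≤k : 1 ≤ k
    1≤k = ≤-trans (s≤s z≤n) (≤-trans 4≤g g≤k)

    suc≤+k : ∀ x → suc x ≤ x + k
    suc≤+k x = subst (_≤ x + k) (+-comm x 1) (+-monoʳ-≤ x 1≤k)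

    runEnds : ∀ {p i} → b p ≡ false → b i ≡ true → i ≤ p + k →
              ∃[ e ] (i ≤ e × e < p + k × ConstantOn b i e × b (suc e) ≡ false)
    runEnds {p} {i} bp bi i≤p+k with nextChange b (p + k) i≤p+k
    ... | inj₁ constant = ⊥-elim (true≢false (begin
          true       ≡⟨ bi ⟨
          b i        ≡⟨ constant (p + k) i≤p+k ≤-refl ⟨
          b (p + k)  ≡⟨ periodic p ⟩
          b p        ≡⟨ bp ⟩
          false      ∎))
      where open ≡-Reasoning
    ... | inj₂ (e , i≤e , e<p+k , constant , change) = e , i≤e , e<p+k , constant , flip-true bi change

    gap≥4 : ∀ {x y} → x + g < suc y → x + 4 ≤ y
    gap≥4 {x} x+g<1+y = ≤-trans (+-monoʳ-≤ x 4≤g) (≤-pred x+g<1+y)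

    onlyRun : ∀ {p e} → b (suc p) ≡ true → suc p ≤ e → e < p + k → ConstantOn b (suc p) e →
              b (suc e) ≡ false → ConstantOn b (suc e) (p + k) → Run k b (suc p) (e ∸ p) × e ∸ p + g ≤ k
    onlyRun {p} {e} b1+p 1+p≤e e<p+k run b1+e gapToEnd = (ℓ≤k , inRun , afterRun) , bound
      where
        p+ℓ≡e = m+[n∸m]≡n (≤-trans (n≤1+n p) 1+p≤e)
        ℓ≤k : e ∸ p ≤ k
        ℓ≤k = ≤-trans (∸-monoˡ-≤ p (<⇒≤ e<p+k)) (≤-reflexive (m+n∸m≡n p k))
        inRun : ∀ t → t < e ∸ p → b (suc p + t) ≡ true
        inRun t t<ℓ = trans (run (suc p + t) (s≤s (m≤m+n p t)) (≤-trans (+-monoʳ-< p t<ℓ) (≤-reflexive p+ℓ≡e))) b1+p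
        afterRun : ∀ t → e ∸ p ≤ t → t < k → b (suc p + t) ≡ false
        afterRun t ℓ≤t t<k =
          trans (gapToEnd (suc p + t) (s≤s (subst (_≤ p + t) p+ℓ≡e (+-monoʳ-≤ p ℓ≤t))) (+-monoʳ-< p t<k)) b1+e
        bound : e ∸ p + g ≤ k
        bound = +-cancelˡ-≤ p (e ∸ p + g) k (begin
          p + (e ∸ p + g)  ≡⟨ +-assoc p (e ∸ p) g ⟨
          p + (e ∸ p) + g  ≡⟨ cong (_+ g) p+ℓ≡e ⟩
          e + g            ≤⟨ ≤-pred (gaps (≤-trans e<p+k (n≤1+n _)) (trans (run e 1+p≤e ≤-refl) b1+p) b1+e
                                           (trans (periodic (suc p)) b1+p)) ⟩
          p + k            ∎)
          where open ≤-Reasoning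

    anotherRun : ∀ {p e q} → b p ≡ false → b (suc p) ≡ true → suc p ≤ e → b e ≡ true → b (suc e) ≡ false →
                 e ≤ q → 2 + q ≤ p + k → ConstantOn b (suc e) (suc q) → b (2 + q) ≡ true → TwoRuns k b
    anotherRun {p} {e} {q} bp b1+p 1+p≤e be b1+e e≤q 2+q≤p+k gap b2+q
      with runEnds bp b2+q 2+q≤p+k
    ... | f , 2+q≤f , f<p+k , secondRun , b1+f = record
      { p = p ; q = q ; s = f
      ; 3+p≤q = 3+p≤q
      ; 2+q≤s = 2+q≤f
      ; 4+s≤p+k = subst (_≤ p + k) (+-comm f 4)
                    (gap≥4 (gaps (≤-trans f<p+k (n≤1+n _)) bf b1+f (trans (periodic (suc p)) b1+p)))
      ; false-p = bp
      ; true-1+p = b1+p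
      ; false-q = trans (gap q (≤-trans (subst (suc e ≤_) (+-comm 3 e) (s≤s (m≤n+m e 2))) e+3≤q) (n≤1+n q)) b1+e
      ; true-2+q = b2+q
      ; true-s = bf
      ; false-2+s = b2+f
      }
      where
        bf = trans (secondRun f 2+q≤f ≤-refl) b2+q
        e+3≤q : e + 3 ≤ q
        e+3≤q = ≤-pred (subst (_≤ suc q) (+-suc e 3) (gap≥4 (gaps (s≤s (≤-trans e≤q (n≤1+n q))) be b1+e b2+q)))
        3+p≤q : 3 + p ≤ q
        3+p≤q = begin
          3 + p  ≤⟨ s≤s (s≤s 1+p≤e) ⟩
          2 + e  ≤⟨ n≤1+n _ ⟩
          3 + e  ≡⟨ +-comm 3 e ⟩
          e + 3  ≤⟨ e+3≤q ⟩
          q      ∎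
          where open ≤-Reasoning
        b2+f : b (2 + f) ≡ false
        b2+f with b (2 + f) in b2+f≡
        ... | false = refl
        ... | true = ⊥-elim (<-irrefl refl (begin-strict
              2 + f  ≡⟨ +-comm 2 f ⟩
              f + 2  ≤⟨ +-monoʳ-≤ f (≤-trans (s≤s (s≤s z≤n)) 4≤g) ⟩
              f + g  <⟨ gaps (n≤1+n _) bf b1+f b2+f≡ ⟩
              2 + f  ∎))
          where open ≤-Reasoning

  runAfterUpStep : ∀ p → b p ≡ false → b (suc p) ≡ true → ∃[ ℓ ] Run k b (suc p) ℓ × ℓ + g ≤ k
  runAfterUpStep p bp b1+p with runEnds bp b1+p (suc≤+k p)
  ... | e , 1+p≤e , e<p+k , firstRun , b1+e with nextChange b (p + k) e<p+k
  ...   | inj₁ gapToEnd = e ∸ p , onlyRun b1+p 1+p≤e e<p+k firstRun b1+e gapToEnd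
  ...   | inj₂ (zero , () , _)
  ...   | inj₂ (suc q , s≤s e≤q , 2+q≤p+k , gap , change) =
    ⊥-elim (¬twoRuns (anotherRun bp b1+p 1+p≤e (trans (firstRun e 1+p≤e ≤-refl) b1+p) b1+e e≤q 2+q≤p+k gap
                                 (flip-false b1+e change)))

  private
    upStepAfter : ∀ {t} → b t ≡ true → b (suc t) ≡ false → ∃[ p ] b p ≡ false × b (suc p) ≡ true
    upStepAfter {t} bt b1+t with nextChange b (t + k) (suc≤+k t)
    ... | inj₁ falseUntilPeriod = ⊥-elim (true≢false (begin
          true       ≡⟨ bt ⟨
          b t        ≡⟨ periodic t ⟨
          b (t + k)  ≡⟨ falseUntilPeriod (t + k) (suc≤+k t) ≤-refl ⟩
          b (suc t)  ≡⟨ b1+t ⟩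
          false      ∎))
      where open ≡-Reasoning
    ... | inj₂ (u , 1+t≤u , _ , falseRun , change) =
      u , trans (falseRun u 1+t≤u ≤-refl) b1+t , flip-false b1+t change

    constantOrUpStep : ConstantOn b 0 k ⊎ ∃[ p ] b p ≡ false × b (suc p) ≡ true
    constantOrUpStep with nextChange b k z≤n | b 0 ≟ᵇ false
    ... | inj₁ constant | _ = inj₁ constant
    ... | inj₂ (t , _ , _ , constant , change) | yes b0 =
      inj₂ (t , trans (constant t z≤n ≤-refl) b0 , flip-false b0 change)
    ... | inj₂ (t , _ , _ , constant , change) | no b0≢false =
      inj₂ (upStepAfter (trans (constant t z≤n ≤-refl) (¬-not b0≢false)) (flip-true (¬-not b0≢false) change))

  singleRun : ∃₂ λ p ℓ → Run k b p ℓ × (ℓ ≡ k ⊎ ℓ + g ≤ k)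
  singleRun with constantOrUpStep | b 0 ≟ᵇ true
  ... | inj₁ constant | yes b0 =
    0 , k , (≤-refl , (λ t t<k → trans (constant t z≤n (<⇒≤ t<k)) b0) , (λ t k≤t t<k → ⊥-elim (<⇒≱ t<k k≤t))) ,
    inj₁ refl
  ... | inj₁ constant | no b0≢true =
    0 , 0 , (z≤n , (λ t ()) , (λ t _ t<k → trans (constant t z≤n (<⇒≤ t<k)) (¬-not b0≢true))) , inj₂ g≤k
  ... | inj₂ (p , bp , b1+p) | _ with runAfterUpStep p bp b1+p
  ...   | ℓ , run , bound = suc p , ℓ , run , inj₂ bound

-- The closed neighbourhood of a vertex on a hole

module OutsideVertex {G : Graph} (pre : Prereduced G) {k} {C : ℕ → Fin (n G)} (hole : CyclicHole G k C)
                     (v : Fin (n G)) (v∉C : ∀ x → v ≢ C x) where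

  open CyclicHole hole

  neighbour : ℕ → Bool
  neighbour x = adj G v (C x)

  private
    far-v : ∀ {x} → neighbour x ≡ false → Far G v (C x)
    far-v {x} non = v∉C x , (λ vCx → true≢false (trans (sym vCx) non))

  fan : ℕ → ℕ → Fin (n G)
  fan x zero = v
  fan x (suc t) = C (x + t)

  fanCycle : ∀ {x d} → 2 ≤ d → d + 2 ≤ k → neighbour x ≡ true → neighbour (x + d) ≡ true →
             (∀ e → 0 < e → e < d → neighbour (x + e) ≡ false) → InducedCycle G (suc d) (fan x)
  fanCycle {x} {d} 2≤d d+2≤k first last between = record
    { long      = s≤s 2≤d
    ; edge      = λ { zero _ → subst (λ y → Adj G v (C y)) (sym (+-identityʳ x)) first
                    ; (suc t) _ → CyclicHole.edge segment t }
    ; closing   = Adj-sym G last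
    ; chordless = chordless
    }
    where
      segment = rotateHole hole x
      chordless : ∀ {t u} → 2 + t ≤ u → u ≤ suc d → u < t + suc d → Far G (fan x t) (fan x u)
      chordless {zero} {suc u} (s≤s 1≤u) _ (s≤s u<d) = far-v (between u 1≤u u<d)
      chordless {suc t} {suc u} (s≤s 2+t≤u) (s≤s u≤d) _ =
        CyclicHole.far segment 2+t≤u
          (≤-trans (subst (2 + u ≤_) (+-comm 2 d) (s≤s (s≤s u≤d))) (≤-trans d+2≤k (m≤n+m k t)))

  gaps : GapsAtLeast 8 neighbour
  gaps {x} {y} x<y adj-x ¬adj-1+x adj-y with nextChange neighbour y x<y
  ... | inj₁ nonUntilY = ⊥-elim (true≢false (trans (sym adj-y) (trans (nonUntilY y x<y ≤-refl) ¬adj-1+x)))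
  ... | inj₂ (t , 1+x≤t , t<y , nonRun , change) with x + 8 <? suc t
  ...   | yes x+8<1+t = <-≤-trans x+8<1+t t<y
  ...   | no x+8≮1+t = ⊥-elim (noShortInducedCycle pre
            (fanCycle 2≤d (≤-trans (+-monoˡ-≤ 2 d≤8) (≤-trans (n≤1+n 10) (holeLength≥11 pre hole)))
                      adj-x (subst (λ z → neighbour z ≡ true) (sym x+d≡1+t) (¬-not change′)) between)
            (s≤s d≤8))
    where
      x≤1+t = ≤-trans (n≤1+n x) (≤-trans 1+x≤t (n≤1+n t))
      d = suc t ∸ x
      x+d≡1+t : x + d ≡ suc t
      x+d≡1+t = m+[n∸m]≡n x≤1+t
      change′ : neighbour (suc t) ≢ false
      change′ eq = change (trans eq (sym ¬adj-1+x))
      2≤d : 2 ≤ d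
      2≤d = +-cancelˡ-≤ x 2 d (subst₂ _≤_ (+-comm 2 x) (sym x+d≡1+t) (s≤s 1+x≤t))
      d≤8 : d ≤ 8
      d≤8 = +-cancelˡ-≤ x d 8 (subst (_≤ x + 8) (sym x+d≡1+t) (≮⇒≥ x+8≮1+t))
      between : ∀ e → 0 < e → e < d → neighbour (x + e) ≡ false
      between e 0<e e<d = trans (nonRun (x + e) (subst (_≤ x + e) (+-comm x 1) (+-monoʳ-≤ x 0<e))
                                  (≤-pred (subst (x + e <_) x+d≡1+t (+-monoʳ-< x e<d))))
                                ¬adj-1+x

  noTwoRuns : ¬ TwoRuns k neighbour
  noTwoRuns two = noSmallAsteroidalTriple {G} pre record
    { centre = v ; end₁ = C q ; end₂ = C (2 + s) ; end₃ = C p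
    ; arm₁ = true-2+q ∷ Adj-sym G (edge (suc q)) ∷ Adj-sym G (edge q) ∷ []
    ; arm₂ = true-s ∷ edge s ∷ edge (suc s) ∷ []
    ; arm₃ = true-1+p ∷ Adj-sym G (edge p) ∷ []
    ; avoids₁₂ = far-v false-2+s ∷ window p≤2+q (s≤s (s≤s 2+q≤s)) ≤-refl
               ∷ window p≤1+q (s≤s (s≤s 1+q≤s)) ≤-refl ∷ window p≤q (s≤s (s≤s q≤s)) ≤-refl ∷ []
    ; avoids₁₃ = far-v false-p ∷ Far-sym G (window ≤-refl 2+p≤2+q 2+q≤2+s)
               ∷ Far-sym G (window ≤-refl 2+p≤1+q 1+q≤2+s) ∷ Far-sym G (window ≤-refl 2+p≤q q≤2+s) ∷ []
    ; avoids₂₁ = far-v false-q ∷ Far-sym G (window p≤q 2+q≤s s≤2+s)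
               ∷ Far-sym G (window p≤q (≤-trans 2+q≤s (n≤1+n s)) 1+s≤2+s) ∷ Far-sym G (window p≤q 2+q≤2+s ≤-refl) ∷ []
    ; avoids₂₃ = far-v false-p ∷ Far-sym G (window ≤-refl 2+p≤s s≤2+s)
               ∷ Far-sym G (window ≤-refl (≤-trans 2+p≤s (n≤1+n s)) 1+s≤2+s) ∷ Far-sym G (window ≤-refl 2+p≤2+s ≤-refl) ∷ []
    ; avoids₃₁ = far-v false-q ∷ window (n≤1+n p) 3+p≤q q≤2+s ∷ window ≤-refl 2+p≤q q≤2+s ∷ []
    ; avoids₃₂ = far-v false-2+s ∷ window (n≤1+n p) (≤-trans 3+p≤q (≤-trans q≤s s≤2+s)) ≤-refl
               ∷ window ≤-refl 2+p≤2+s ≤-refl ∷ []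
    } (n≤1+n 9)
    where
      open TwoRuns two
      window : ∀ {i j} → p ≤ i → 2 + i ≤ j → j ≤ 2 + s → Far G (C i) (C j)
      window p≤i 2+i≤j j≤2+s = far 2+i≤j (≤-trans (s≤s (s≤s j≤2+s)) (≤-trans 4+s≤p+k (+-monoˡ-≤ k p≤i)))
      q≤s = ≤-trans (m≤n+m q 2) 2+q≤s
      1+q≤s = ≤-trans (n≤1+n (suc q)) 2+q≤s
      2+p≤q = ≤-trans (n≤1+n (2 + p)) 3+p≤q
      p≤q = ≤-trans (m≤n+m p 2) 2+p≤q
      p≤1+q = ≤-trans p≤q (n≤1+n q)
      p≤2+q = ≤-trans p≤1+q (n≤1+n (suc q))
      s≤2+s = m≤n+m s 2
      1+s≤2+s = n≤1+n (suc s)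
      q≤2+s = ≤-trans q≤s s≤2+s
      1+q≤2+s = ≤-trans 1+q≤s s≤2+s
      2+q≤2+s = ≤-trans 2+q≤s s≤2+s
      2+p≤1+q = ≤-trans 2+p≤q (n≤1+n q)
      2+p≤2+q = ≤-trans 2+p≤1+q (n≤1+n (suc q))
      2+p≤s = ≤-trans 2+p≤q q≤s
      2+p≤2+s = ≤-trans 2+p≤s s≤2+s

  neighbourRun : ∃₂ λ p ℓ → Run k neighbour p ℓ × (ℓ ≡ k ⊎ ℓ + 8 ≤ k)
  neighbourRun = singleRun (λ x → cong (adj G v) (periodic x)) (s≤s (s≤s (s≤s (s≤s z≤n))))
                           (≤-trans (n≤1+n 8) (≤-trans (n≤1+n 9) (≤-trans (n≤1+n 10) (holeLength≥11 pre hole))))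
                           gaps noTwoRuns

inClosedNbhd : (G : Graph) → Fin (n G) → Fin (n G) → Bool
inClosedNbhd G v u = does (u ≟ v) ∨ adj G v u

module _ {G : Graph} {k : ℕ} (h : Fin k → Fin (n G)) where

  private
    holeSet-lookup : ∀ u → lookup (holeSet G h) u ≡ does (any? λ i → h i ≟ u)
    holeSet-lookup u = lookup∘tabulate (λ x → does (any? λ i → h i ≟ x)) u

  ∈holeSet⁺ : ∀ i → h i ∈ holeSet G h
  ∈holeSet⁺ i = lookup⇒[]= (h i) (holeSet G h) (trans (holeSet-lookup (h i)) (dec-true (any? λ j → h j ≟ h i) (i , refl)))

  ∈holeSet⁻ : ∀ {u} → u ∈ holeSet G h → ∃[ i ] h i ≡ u
  ∈holeSet⁻ {u} u∈ with any? (λ i → h i ≟ u) | trans (sym (holeSet-lookup u)) ([]=⇒lookup u∈)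
  ... | yes found | _ = found
  ... | no _ | ()

  lookup-nbhdInHole : ∀ v i → lookup (nbhdInHole G h v) (h i) ≡ inClosedNbhd G v (h i)
  lookup-nbhdInHole v i = begin
    lookup (closedNbhd G v ∩ holeSet G h) (h i)               ≡⟨ lookup-zipWith _∧_ (h i) (closedNbhd G v) (holeSet G h) ⟩
    lookup (closedNbhd G v) (h i) ∧ lookup (holeSet G h) (h i) ≡⟨ cong₂ _∧_ (lookup∘tabulate (inClosedNbhd G v) (h i))
                                                                           ([]=⇒lookup (∈holeSet⁺ i)) ⟩
    inClosedNbhd G v (h i) ∧ true                               ≡⟨ ∧-identityʳ _ ⟩
    inClosedNbhd G v (h i)                                      ∎
    where open ≡-Reasoning

module HoleSubset {G : Graph} {k : ℕ} .{{_ : NonZero k}} (h : Fin k → Fin (n G))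
                  (S : Subset (n G)) (S⊆hole : S ⊆ holeSet G h)
                  {p ℓ : ℕ} (run : Run k (λ x → lookup S (h (x mod k))) p ℓ) where

  private
    H : ℕ → Fin (n G)
    H x = h (x mod k)

    H-residue : ∀ {x i} → x % k ≡ toℕ i → H x ≡ h i
    H-residue eq = cong h (toℕ-injective (trans (toℕ-mod _) eq))

    inside-run : ∀ {t} → t < ℓ → H (p + t) ∈ S
    inside-run t<ℓ = lookup⇒[]= _ S (proj₁ (proj₂ run) _ t<ℓ)

    offsetInRun : ∀ i → h i ∈ S → ∀ {t} → t < k → (p + t) % k ≡ toℕ i → t < ℓ
    offsetInRun i hi∈S {t} t<k p+t≡i with t <? ℓ
    ... | yes t<ℓ = t<ℓ
    ... | no t≮ℓ = ⊥-elim (true≢false (begin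
          true               ≡⟨ []=⇒lookup hi∈S ⟨
          lookup S (h i)     ≡⟨ cong (lookup S) (H-residue p+t≡i) ⟨
          lookup S (H (p + t)) ≡⟨ proj₂ (proj₂ run) t (≮⇒≥ t≮ℓ) t<k ⟩
          false              ∎))
      where
        open ≡-Reasoning

  consecutive : Consecutive G k h S
  consecutive = p mod k , ℓ , proj₁ run , λ i → mk⇔ (to i) (from i)
    where
      fromStart : ∀ t → (toℕ (p mod k) + t) % k ≡ (p + t) % k
      fromStart t = trans (cong (λ r → (r + t) % k) (toℕ-mod p)) (%-absorbˡ p t)
      to : ∀ i → h i ∈ S → ∃[ t ] (t < ℓ × toℕ i ≡ (toℕ (p mod k) + t) % k)
      to i hi∈S with ∃offset p i
      ... | t , t<k , p+t≡i = t , offsetInRun i hi∈S t<k p+t≡i , sym (trans (fromStart t) p+t≡i)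
      from : ∀ i → ∃[ t ] (t < ℓ × toℕ i ≡ (toℕ (p mod k) + t) % k) → h i ∈ S
      from i (t , t<ℓ , i≡) = subst (_∈ S) (H-residue (sym (trans i≡ (fromStart t)))) (inside-run t<ℓ)

  ∣S∣≤ℓ : ∣ S ∣ ≤ ℓ
  ∣S∣≤ℓ = begin
    ∣ S ∣              ≤⟨ p⊆q⇒∣p∣≤∣q∣ S⊆segment ⟩
    ∣ setOf segment ∣  ≤⟨ ∣setOf∣≤length segment ⟩
    length segment     ≡⟨ length-applyUpTo _ ℓ ⟩
    ℓ                  ∎
    where
      open ≤-Reasoning
      segment = applyUpTo (λ t → H (p + t)) ℓ
      S⊆segment : S ⊆ setOf segment
      S⊆segment u∈S with ∈holeSet⁻ {G} h (S⊆hole u∈S)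
      ... | i , refl with ∃offset p i
      ... | t , t<k , p+t≡i = ∈setOf⁺ (subst (_∈ˡ segment) (H-residue p+t≡i)
                                         (∈-applyUpTo⁺ _ (offsetInRun i u∈S t<k p+t≡i)))

  whole : ℓ ≡ k → S ≡ holeSet G h
  whole ℓ≡k = ⊆-antisym S⊆hole hole⊆S
    where
      hole⊆S : holeSet G h ⊆ S
      hole⊆S u∈hole with ∈holeSet⁻ {G} h u∈hole
      ... | i , refl with ∃offset p i
      ... | t , t<k , p+t≡i = subst (_∈ S) (H-residue p+t≡i) (inside-run (subst (t <_) (sym ℓ≡k) t<k))

vertexOnHoleRun : ∀ {G k C} → CyclicHole G k C → ∀ p → Run k (λ x → inClosedNbhd G (C (suc p)) (C x)) p 3
vertexOnHoleRun {G} {k} {C} hole p = ≤-trans (n≤1+n 3) long , near , far-off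
  where
    open CyclicHole hole
    v = C (suc p)
    neighbour : ∀ {x} → Adj G v (C x) → inClosedNbhd G v (C x) ≡ true
    neighbour {x} v-x = trans (cong (does (C x ≟ v) ∨_) v-x) (∨-zeroʳ _)
    near : ∀ t → t < 3 → inClosedNbhd G v (C (p + t)) ≡ true
    near 0 _ = neighbour (subst (λ y → Adj G v (C y)) (sym (+-identityʳ p)) (Adj-sym G (edge p)))
    near 1 _ = cong (_∨ adj G v (C (p + 1))) (dec-true (C (p + 1) ≟ v) (cong C (+-comm p 1)))
    near 2 _ = neighbour (subst (λ y → Adj G v (C y)) (+-comm 2 p) (edge (suc p)))
    near (suc (suc (suc t))) (s≤s (s≤s (s≤s ())))
    far-off : ∀ t → 3 ≤ t → t < k → inClosedNbhd G v (C (p + t)) ≡ false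
    far-off t 3≤t t<k with far (subst (_≤ p + t) (+-comm p 3) (+-monoʳ-≤ p 3≤t)) (s≤s (+-monoʳ-< p t<k))
    ... | v≢C , ¬v-C = cong₂ _∨_ (dec-false (C (p + t) ≟ v) (λ C≡v → v≢C (sym C≡v))) (¬-not ¬v-C)

closedNbhdRun : ∀ {G} → Prereduced G → ∀ v {k} .{{_ : NonZero k}} {h} → IsHole G k h →
                ∃₂ λ p ℓ → Run k (λ x → lookup (nbhdInHole G h v) (h (x mod k))) p ℓ × (ℓ ≡ k ⊎ ℓ + 8 ≤ k)
closedNbhdRun {G} pre v {k} {h} isHole with any? (λ i → h i ≟ v)
... | yes (i , hi≡v) =
  p , 3 , Run-cong onHole (vertexOnHoleRun hole p) , inj₂ (holeLength≥11 {G} pre hole)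
  where
    hole = unfoldHole {G} isHole
    p = toℕ i + pred k
    centre : h (suc p mod k) ≡ v
    centre = begin
      h (suc p mod k)         ≡⟨ cong (λ x → h (x mod k)) (sym (+-suc (toℕ i) (pred k))) ⟩
      h ((toℕ i + suc (pred k)) mod k) ≡⟨ cong (λ x → h ((toℕ i + x) mod k)) (suc-pred k) ⟩
      h ((toℕ i + k) mod k)   ≡⟨ CyclicHole.periodic hole (toℕ i) ⟩
      h (toℕ i mod k)         ≡⟨ cong h (toℕ-injective (trans (toℕ-mod (toℕ i)) (m<n⇒m%n≡m (toℕ<n i)))) ⟩
      h i                     ≡⟨ hi≡v ⟩
      v                       ∎
      where open ≡-Reasoning
    onHole : ∀ x → inClosedNbhd G (h (suc p mod k)) (h (x mod k)) ≡ lookup (nbhdInHole G h v) (h (x mod k))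
    onHole x = trans (cong (λ w → inClosedNbhd G w (h (x mod k))) centre) (sym (lookup-nbhdInHole {G} h v (x mod k)))
... | no v∉h with OutsideVertex.neighbourRun {G} pre (unfoldHole {G} isHole) v (λ x v≡ → v∉h (x mod k , sym v≡))
...   | p , ℓ , run , bound = p , ℓ , Run-cong off-hole run , bound
  where
    off-hole : ∀ x → adj G v (h (x mod k)) ≡ lookup (nbhdInHole G h v) (h (x mod k))
    off-hole x = sym (trans (lookup-nbhdInHole {G} h v (x mod k))
                           (cong (_∨ adj G v (h (x mod k))) (dec-false (h (x mod k) ≟ v) (λ h≡v → v∉h (x mod k , h≡v)))))

proposition6p1 : (G : Graph) → Prereduced G → (v : Fin (n G)) →
    (k : ℕ) .{{_ : NonZero k}} → (h : Fin k → Fin (n G)) → IsHole G k h →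
    Consecutive G k h (nbhdInHole G h v) ×
    (nbhdInHole G h v ≡ holeSet G h ⊎ ∣ nbhdInHole G h v ∣ + 7 < k)
proposition6p1 G pre v k h isHole with closedNbhdRun {G} pre v isHole
... | p , ℓ , run , ℓ≡k⊎ℓ+8≤k =
  consecutive , [ (λ ℓ≡k → inj₁ (whole ℓ≡k)) , (λ ℓ+8≤k → inj₂ (small ℓ+8≤k)) ]′ ℓ≡k⊎ℓ+8≤k
  where
    N = nbhdInHole G h v
    open HoleSubset {G} h N (p∩q⊆q (closedNbhd G v) (holeSet G h)) run
    small : ℓ + 8 ≤ k → ∣ N ∣ + 7 < k
    small ℓ+8≤k = ≤-trans (≤-reflexive (sym (+-suc ∣ N ∣ 7))) (≤-trans (+-monoˡ-≤ 8 ∣S∣≤ℓ) ℓ+8≤k)
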